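{- Let $p,q$ be positive integers. For every positive integer $k$ there exists an integer $N=N(p,q,k)$ such that for every $n\geq N$ and all positive integers $b_1\leq \ldots \leq b_n$ satisfying $\frac{1}{N}\sum_{i=1}^{N} b_i\leq k$, Enforcer has a winning strategy in the game monotone-$mBox(b_1, \ldots, b_n,(p,q))$, both as the first and as the second player.
   Context: In a $(p,q)$ Avoider-Enforcer game on a finite board $X$ with target family $\mathcal F\subseteq 2^X$ played according to the monotone rules, Avoider and Enforcer alternately claim at least $p$ and at least $q$ previously unclaimed elements of $X$ per move, respectively; if fewer than $p$ (resp. $q$) unclaimed elements remain before Avoider's (resp. Enforcer's) move, he claims all of them. It is specified which player moves first. The game ends when all elements are claimed; Avoider loses (Enforcer wins) if at the end Avoider has claimed all elements of some target set, otherwise Avoider wins. The game monotone-$mBox(b_1,\ldots,b_n,(p,q))$ is this game (monotone rules) on the board consisting of the disjoint union of pairwise disjoint sets (boxes) $B_1,\ldots,B_n$ with $|B_i|=b_i$, with target sets exactly $B_1,\ldots,B_n$. -}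

module Defs where

open import Data.Nat using (ℕ; zero; suc; _+_; _*_; _≤_; _<_; _<?_; _≤?_)
open import Data.Fin using (Fin; toℕ)
import Data.Fin as F
open import Data.Bool using (Bool; true; false; if_then_else_; _∧_)
open import Data.Vec using (Vec; lookup; tabulate; replicate)
open import Data.Fin.Subset using (Subset; _∈_; ∣_∣)
open import Data.Product using (Σ; _×_)
open import Data.Sum using (_⊎_)
open import Relation.Nullary using (¬_)
open import Relation.Nullary.Decidable using (⌊_⌋)
open import Relation.Binary.PropositionalEquality using (_≡_)

data Owner : Set where
  free avoider enforcer : Owner

data Player : Set where
  Avoider Enforcer : Player

Position : ℕ → Set
Position m = Vec Owner m

initial : ∀ {m} → Position m
initial = replicate _ free

IsOver : ∀ {m} → Position m → Set
IsOver {m} pos = (x : Fin m) → ¬ (lookup pos x ≡ free)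

-- A legal move under monotone rules with bound r: a set S of previously
-- unclaimed elements with |S| ≥ r, or (if fewer than r remain) all of them.
-- (If S contains all unclaimed elements and ≥ r remain, then |S| ≥ r anyway.)
Legal : ∀ {m} → ℕ → Position m → Subset m → Set
Legal {m} r pos S =
  ((x : Fin m) → x ∈ S → lookup pos x ≡ free) ×
  (r ≤ ∣ S ∣ ⊎ ((x : Fin m) → lookup pos x ≡ free → x ∈ S))

claim : ∀ {m} → Owner → Subset m → Position m → Position m
claim o S pos = tabulate (λ x → if lookup S x then o else lookup pos x)

AvoiderLost : ∀ {m t} → (Fin t → Subset m) → Position m → Set
AvoiderLost {m} {t} ℱ pos =
  Σ (Fin t) (λ j → (x : Fin m) → x ∈ ℱ j → lookup pos x ≡ avoider)

-- EnforcerWins p q ℱ pl pos : Enforcer has a winning strategy in the (p,q)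
-- Avoider-Enforcer game with target family ℱ, from position pos with pl to move.
-- (Inductive, i.e. least fixed point; every move claims ≥ 1 element so the game is finite.)
data EnforcerWins {m t : ℕ} (p q : ℕ) (ℱ : Fin t → Subset m)
       : Player → Position m → Set where
  done : ∀ {pl pos} → IsOver pos → AvoiderLost ℱ pos → EnforcerWins p q ℱ pl pos
  enfMove : ∀ {pos} → ¬ IsOver pos → (S : Subset m) → Legal q pos S →
            EnforcerWins p q ℱ Avoider (claim enforcer S pos) →
            EnforcerWins p q ℱ Enforcer pos
  avoMove : ∀ {pos} → ¬ IsOver pos →
            ((S : Subset m) → Legal p pos S →
               EnforcerWins p q ℱ Enforcer (claim avoider S pos)) →
            EnforcerWins p q ℱ Avoider pos

sumFin : (n : ℕ) → (Fin n → ℕ) → ℕ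
sumFin zero    b = 0
sumFin (suc n) b = b F.zero + sumFin n (λ i → b (F.suc i))

-- Σ_{i < N} b i (indices counted from 0, i.e. b_1 + ... + b_N in the paper)
prefixSum : (N : ℕ) → {n : ℕ} → (Fin n → ℕ) → ℕ
prefixSum N {n} b = sumFin n (λ i → if ⌊ toℕ i <? N ⌋ then b i else 0)

boxStart : {n : ℕ} → (Fin n → ℕ) → Fin n → ℕ
boxStart b i = prefixSum (toℕ i) b

-- Box i: the elements x with boxStart i ≤ x < boxStart i + b i.
-- The boxes partition the board Fin (sumFin n b) into consecutive blocks of sizes b i.
box : {n : ℕ} → (b : Fin n → ℕ) → Fin n → Subset (sumFin n b)
box b i = tabulate (λ x →
  ⌊ boxStart b i ≤? toℕ x ⌋ ∧ ⌊ toℕ x <? boxStart b i + b i ⌋)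

EnforcerWinsBox : (p q : ℕ) → {n : ℕ} → (b : Fin n → ℕ) → Player → Set
EnforcerWinsBox p q b pl = EnforcerWins p q (box b) pl initial

-- Theorem 1.7: for p, q, k ≥ 1 there is N such that Enforcer wins
-- monotone-mBox(b₁, …, bₙ, (p, q)) as first and as second player whenever
-- n ≥ N, all bᵢ ≥ 1 and b₁ + … + b_N ≤ k·N.  By Markov's inequality at least G(2k) + q boxes have at
-- most 2k elements.  Enforcer only "kills" boxes (claims all their free
-- cells), so boxes with an Enforcer cell are full ("clean" positions) and
-- "live" boxes can still be filled by Avoider.  If Avoider leaves a live box
-- with at most p free cells, Enforcer claims everything else and Avoider
-- must fill it; otherwise Enforcer kills q fullest live boxes.  In phase u all
-- boxes have at most p + 1 + u free cells and the potential
-- p·L₀ + q·Z ≤ (p + q·u)·L (L live boxes, Z free cells beyond p + 1 per box)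
-- keeps L large until the phase drops; phase 0 admits no safe Avoider move.
module Submission where

open import Defs
open import Data.Nat using (ℕ; zero; suc; _+_; _*_; _∸_; _≤_; _<_; z≤n; s≤s; s≤s⁻¹; _≤?_; _<?_; NonZero; >-nonZero)
open import Data.Nat.Properties
open import Data.Fin using (Fin; toℕ)
import Data.Fin as F
import Data.Fin.Properties as FinP
open import Data.Bool using (Bool; true; false; if_then_else_; _∧_; _∨_; not)
open import Data.Bool.Properties using (∧-comm; ∧-zeroʳ; ∧-identityʳ) renaming (_≟_ to _≟ᵇ_)
open import Data.Product using (Σ; _×_; _,_; proj₁; proj₂)
open import Data.Sum using (_⊎_; inj₁; inj₂)
open import Data.Empty using (⊥; ⊥-elim)
open import Data.Vec using (lookup; tabulate; []; _∷_)
open import Data.Vec.Properties using (lookup∘tabulate; []=⇒lookup; lookup⇒[]=; lookup-replicate)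
open import Data.Vec.Functional using (removeAt)
open import Data.Fin.Subset using (Subset; _∈_; ∣_∣)
open import Function using (_∘_; _⇔_; mk⇔)
open import Relation.Nullary using (¬_; Dec; yes; no)
open import Relation.Nullary.Decidable using (⌊_⌋; isYes≗does; dec-true; dec-false; does-⇔)
open import Relation.Binary.PropositionalEquality hiding (J)
open import Algebra.Properties.CommutativeMonoid.Sum +-0-commutativeMonoid
  using (sum; sum-cong-≗; ∑-distrib-+; ∑-comm; sum-remove; sum-replicate-zero)
open import Algebra.Properties.Semiring.Sum +-*-semiring using (*-distribˡ-sum)
open import Data.Nat.Tactic.RingSolver using (solve-∀)

𝟙 : Bool → ℕ
𝟙 true  = 1
𝟙 false = 0

count : ∀ {k} → (Fin k → Bool) → ℕ
count P = sum (𝟙 ∘ P)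

∧-true : ∀ a {c} → (a ∧ c) ≡ true → a ≡ true × c ≡ true
∧-true true e = refl , e

⌊⌋⇒ : ∀ {a} {A : Set a} (a? : Dec A) → ⌊ a? ⌋ ≡ true → A
⌊⌋⇒ (yes a) _ = a

⌊⌋⇒¬ : ∀ {a} {A : Set a} (a? : Dec A) → ⌊ a? ⌋ ≡ false → ¬ A
⌊⌋⇒¬ (no ¬a) _ = ¬a

⌊⌋-true : ∀ {a} {A : Set a} (a? : Dec A) → A → ⌊ a? ⌋ ≡ true
⌊⌋-true a? a = trans (isYes≗does a?) (dec-true a? a)

⌊⌋-false : ∀ {a} {A : Set a} (a? : Dec A) → ¬ A → ⌊ a? ⌋ ≡ false
⌊⌋-false a? ¬a = trans (isYes≗does a?) (dec-false a? ¬a)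

⌊⌋-⇔ : ∀ {a b} {A : Set a} {B : Set b} → A ⇔ B → (a? : Dec A) (b? : Dec B) → ⌊ a? ⌋ ≡ ⌊ b? ⌋
⌊⌋-⇔ A⇔B a? b? = trans (isYes≗does a?) (trans (does-⇔ A⇔B a? b?) (sym (isYes≗does b?)))

sum-mono : ∀ {k} {f g : Fin k → ℕ} → (∀ x → f x ≤ g x) → sum f ≤ sum g
sum-mono {zero}  f≤g = z≤n
sum-mono {suc k} f≤g = +-mono-≤ (f≤g F.zero) (sum-mono (f≤g ∘ F.suc))

sum-zero : ∀ {k} {f : Fin k → ℕ} → (∀ x → f x ≡ 0) → sum f ≡ 0
sum-zero {k} f≡0 = trans (sum-cong-≗ f≡0) (sum-replicate-zero k)

sum-pos : ∀ {k} (f : Fin k → ℕ) → 1 ≤ sum f → Σ (Fin k) (λ x → 1 ≤ f x)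
sum-pos {suc k} f h with f F.zero in e
... | suc _ = F.zero , subst (1 ≤_) (sym e) (s≤s z≤n)
... | zero  with sum-pos (f ∘ F.suc) h
...   | x , hx = F.suc x , hx

term≤sum : ∀ {k} (f : Fin k → ℕ) (x : Fin k) → f x ≤ sum f
term≤sum {suc k} f x = ≤-trans (m≤m+n (f x) _) (≤-reflexive (sym (sum-remove {i = x} f)))

sum-supported : ∀ {k} (f : Fin k → ℕ) i → (∀ j → j ≢ i → f j ≡ 0) → sum f ≡ f i
sum-supported {suc k} f i vanish = begin
  sum f                     ≡⟨ sum-remove {i = i} f ⟩
  f i + sum (removeAt f i)  ≡⟨ cong (f i +_) (sum-zero {k} (λ j → vanish _ (FinP.punchInᵢ≢i i j))) ⟩
  f i + 0                   ≡⟨ +-identityʳ (f i) ⟩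
  f i                       ∎
  where open ≡-Reasoning

sum-drop-mono : ∀ {k} {f g : Fin k → ℕ} → (∀ j → f j ≤ g j) → ∀ i → sum f + g i ≤ f i + sum g
sum-drop-mono {suc k} {f} {g} f≤g i = begin
  sum f + g i                          ≡⟨ cong (_+ g i) (sum-remove {i = i} f) ⟩
  f i + sum (removeAt f i) + g i       ≡⟨ +-assoc (f i) _ (g i) ⟩
  f i + (sum (removeAt f i) + g i)     ≤⟨ +-monoʳ-≤ (f i) (+-monoˡ-≤ (g i) (sum-mono (f≤g ∘ F.punchIn i))) ⟩
  f i + (sum (removeAt g i) + g i)     ≡⟨ cong (f i +_) (trans (+-comm _ (g i)) (sym (sum-remove {i = i} g))) ⟩
  f i + sum g                          ∎
  where open ≤-Reasoning

sum-if-const : ∀ {k} (J : Fin k → Bool) (c : ℕ) →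
  sum (λ i → if J i then c else 0) ≡ c * count J
sum-if-const J c = trans (sum-cong-≗ (λ i → term (J i))) (sym (*-distribˡ-sum c (𝟙 ∘ J)))
  where
  term : ∀ a → (if a then c else 0) ≡ c * 𝟙 a
  term true  = sym (*-identityʳ c)
  term false = sym (*-zeroʳ c)

∣∣≡count : ∀ {k} (S : Subset k) → ∣ S ∣ ≡ count (lookup S)
∣∣≡count []          = refl
∣∣≡count (true ∷ S)  = cong suc (∣∣≡count S)
∣∣≡count (false ∷ S) = ∣∣≡count S

_⊆ᵇ_ : ∀ {k} → (Fin k → Bool) → (Fin k → Bool) → Set
P ⊆ᵇ Q = ∀ x → P x ≡ true → Q x ≡ true

𝟙-mono : ∀ {a c} → (a ≡ true → c ≡ true) → 𝟙 a ≤ 𝟙 c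
𝟙-mono {true}  a⇒c rewrite a⇒c refl = ≤-refl
𝟙-mono {false} a⇒c = z≤n

count-cong : ∀ {k} {P Q : Fin k → Bool} → (∀ x → P x ≡ Q x) → count P ≡ count Q
count-cong P≗Q = sum-cong-≗ (cong 𝟙 ∘ P≗Q)

count-mono : ∀ {k} {P Q : Fin k → Bool} → P ⊆ᵇ Q → count P ≤ count Q
count-mono P⊆Q = sum-mono (λ x → 𝟙-mono (P⊆Q x))

count-split : ∀ {k} (P Q : Fin k → Bool) →
  count P ≡ count (λ x → P x ∧ Q x) + count (λ x → P x ∧ not (Q x))
count-split P Q =
  trans (sum-cong-≗ (λ x → term (P x) (Q x))) (∑-distrib-+ (λ x → 𝟙 (P x ∧ Q x)) _)
  where
  term : ∀ a c → 𝟙 a ≡ 𝟙 (a ∧ c) + 𝟙 (a ∧ not c)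
  term true  true  = refl
  term true  false = refl
  term false c     = refl

count-≥1 : ∀ {k} (P : Fin k → Bool) (x : Fin k) → P x ≡ true → 1 ≤ count P
count-≥1 P x Px = subst (λ a → 𝟙 a ≤ count P) Px (term≤sum (𝟙 ∘ P) x)

count-witness : ∀ {k} (P : Fin k → Bool) → 1 ≤ count P → Σ (Fin k) (λ x → P x ≡ true)
count-witness P h with sum-pos (𝟙 ∘ P) h
... | x , hx = x , positive (P x) hx
  where
  positive : ∀ a → 1 ≤ 𝟙 a → a ≡ true
  positive true _ = refl

count-zero : ∀ {k} (P : Fin k → Bool) → count P ≡ 0 → ∀ x → P x ≡ false
count-zero P #P≡0 x with P x in Px
... | false = refl
... | true  = ⊥-elim (1+n≰n (subst (1 ≤_) #P≡0 (count-≥1 P x Px)))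

count-mono-< : ∀ {k} {P Q : Fin k → Bool} → P ⊆ᵇ Q → (x : Fin k) →
  P x ≡ false → Q x ≡ true → count P < count Q
count-mono-< {suc k} {P} {Q} P⊆Q x Px Qx = begin-strict
  count P                             ≡⟨ sum-remove {i = x} (𝟙 ∘ P) ⟩
  𝟙 (P x) + sum (removeAt (𝟙 ∘ P) x)  ≡⟨ cong (λ a → 𝟙 a + sum (removeAt (𝟙 ∘ P) x)) Px ⟩
  sum (removeAt (𝟙 ∘ P) x)            <⟨ s≤s (sum-mono (λ j → 𝟙-mono (P⊆Q (F.punchIn x j)))) ⟩
  1 + sum (removeAt (𝟙 ∘ Q) x)        ≡⟨ cong (λ a → 𝟙 a + sum (removeAt (𝟙 ∘ Q) x)) Qx ⟨
  𝟙 (Q x) + sum (removeAt (𝟙 ∘ Q) x)  ≡⟨ sum-remove {i = x} (𝟙 ∘ Q) ⟨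
  count Q                             ∎
  where open ≤-Reasoning

count-∧-const : ∀ {k} (P : Fin k → Bool) c → count (λ x → P x ∧ c) ≡ (if c then count P else 0)
count-∧-const P true  = count-cong (λ x → ∧-identityʳ (P x))
count-∧-const {k} P false = trans (count-cong (λ x → ∧-zeroʳ (P x))) (sum-zero {k} (λ _ → refl))

count-saturate : ∀ {k} {P Q : Fin k → Bool} → P ⊆ᵇ Q → count Q ≤ count P → Q ⊆ᵇ P
count-saturate {P = P} P⊆Q #Q≤#P x Qx with P x in Px
... | true  = refl
... | false = ⊥-elim (<⇒≱ (count-mono-< P⊆Q x Px Qx) #Q≤#P)

count-unique : ∀ {k} (P : Fin k → Bool) → count P ≡ 1 →
  ∀ i j → P i ≡ true → P j ≡ true → i ≡ j
count-unique {suc k} P #P≡1 i j Pi Pj with i F.≟ j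
... | yes i≡j = i≡j
... | no  i≢j = ⊥-elim (1+n≰n (≤-trans two≤#P (≤-reflexive #P≡1)))
  where
  open ≤-Reasoning
  Pj≤rest : 1 ≤ sum (removeAt (𝟙 ∘ P) i)
  Pj≤rest = subst (_≤ sum (removeAt (𝟙 ∘ P) i))
                  (trans (cong (𝟙 ∘ P) (FinP.punchIn-punchOut i≢j)) (cong 𝟙 Pj))
                  (term≤sum (removeAt (𝟙 ∘ P) i) (F.punchOut i≢j))
  two≤#P : 2 ≤ count P
  two≤#P = begin
    2                                   ≡⟨ cong (λ a → 𝟙 a + 1) Pi ⟨
    𝟙 (P i) + 1                         ≤⟨ +-monoʳ-≤ (𝟙 (P i)) Pj≤rest ⟩
    𝟙 (P i) + sum (removeAt (𝟙 ∘ P) i)  ≡⟨ sum-remove {i = i} (𝟙 ∘ P) ⟨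
    count P                             ∎

takeFirst : ∀ {k} → ℕ → (Fin k → Bool) → Fin k → Bool
takeFirst zero    P i         = false
takeFirst (suc r) P F.zero    = P F.zero
takeFirst (suc r) P (F.suc i) = takeFirst (if P F.zero then r else suc r) (P ∘ F.suc) i

takeFirst-⊆ : ∀ {k} r (P : Fin k → Bool) → takeFirst r P ⊆ᵇ P
takeFirst-⊆ (suc r) P F.zero    e = e
takeFirst-⊆ (suc r) P (F.suc i) e with P F.zero
... | true  = takeFirst-⊆ r (P ∘ F.suc) i e
... | false = takeFirst-⊆ (suc r) (P ∘ F.suc) i e

takeFirst-count : ∀ {k} r (P : Fin k → Bool) → r ≤ count P → count (takeFirst r P) ≡ r
takeFirst-count {k}     zero    P h = sum-zero {k} (λ _ → refl)
takeFirst-count {suc k} (suc r) P h with P F.zero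
... | true  = cong suc (takeFirst-count r (P ∘ F.suc) (s≤s⁻¹ h))
... | false = takeFirst-count (suc r) (P ∘ F.suc) h

count-∪-takeFirst : ∀ {k} (A R : Fin k → Bool) (r : ℕ) →
  (∀ i → A i ≡ true → R i ≡ false) → r ≤ count R →
  count (λ i → A i ∨ takeFirst r R i) ≡ count A + r
count-∪-takeFirst A R r disjoint r≤#R = trans (count-split _ A)
  (cong₂ _+_ (count-cong inA) (trans (count-cong outA) (takeFirst-count r R r≤#R)))
  where
  inA : ∀ i → ((A i ∨ takeFirst r R i) ∧ A i) ≡ A i
  inA i with A i | takeFirst r R i
  ... | true  | _     = refl
  ... | false | true  = refl
  ... | false | false = refl
  outA : ∀ i → ((A i ∨ takeFirst r R i) ∧ not (A i)) ≡ takeFirst r R i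
  outA i with A i in Ai | takeFirst r R i in Ti
  ... | false | true  = refl
  ... | false | false = refl
  ... | true  | false = refl
  ... | true  | true  with () ← trans (sym (disjoint i Ai)) (takeFirst-⊆ r R i Ti)

inInterval : ℕ → ℕ → ℕ → Bool
inInterval c d v = ⌊ c ≤? v ⌋ ∧ ⌊ v <? c + d ⌋

inInterval-shift : ∀ a c d w → inInterval (a + c) d (a + w) ≡ inInterval c d w
inInterval-shift a c d w = cong₂ _∧_
  (⌊⌋-⇔ (mk⇔ (+-cancelˡ-≤ a c w) (+-monoʳ-≤ a)) (a + c ≤? a + w) (c ≤? w))
  (trans (cong (λ e → ⌊ a + w <? e ⌋) (+-assoc a c d))
         (⌊⌋-⇔ (mk⇔ (+-cancelˡ-< a w (c + d)) (+-monoʳ-< a)) (a + w <? a + (c + d)) (w <? c + d)))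

inInterval-below : ∀ {a v} c d → v < a → inInterval (a + c) d v ≡ false
inInterval-below {a} {v} c d v<a =
  cong (_∧ ⌊ v <? a + c + d ⌋) (⌊⌋-false (a + c ≤? v) (λ a+c≤v → <⇒≱ v<a (≤-trans (m≤m+n a c) a+c≤v)))

not-<? : ∀ v c → not ⌊ v <? c ⌋ ≡ ⌊ c ≤? v ⌋
not-<? v c with v <? c | c ≤? v
... | yes _   | no _    = refl
... | no _    | yes _   = refl
... | yes v<c | yes c≤v = ⊥-elim (<⇒≱ v<c c≤v)
... | no v≮c  | no c≰v  = ⊥-elim (c≰v (≮⇒≥ v≮c))

sumFin≡sum : ∀ n (f : Fin n → ℕ) → sumFin n f ≡ sum f
sumFin≡sum zero    f = refl
sumFin≡sum (suc n) f = cong (f F.zero +_) (sumFin≡sum n (f ∘ F.suc))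

prefixSum-zero : ∀ {n} (b : Fin n → ℕ) → prefixSum 0 b ≡ 0
prefixSum-zero {n} b = trans (sumFin≡sum n _)
  (sum-zero {n} (λ i → cong (λ t → if t then b i else 0) (⌊⌋-false (toℕ i <? 0) λ ())))

prefixSum-suc : ∀ {n} (b : Fin (suc n) → ℕ) (N : ℕ) →
  prefixSum (suc N) b ≡ b F.zero + prefixSum N (b ∘ F.suc)
prefixSum-suc {n} b N = cong₂ _+_
  (cong (λ t → if t then b F.zero else 0) (⌊⌋-true (0 <? suc N) (s≤s z≤n)))
  (trans (sumFin≡sum n _) (trans (sum-cong-≗ shift) (sym (sumFin≡sum n _))))
  where
  shift : ∀ i → (if ⌊ suc (toℕ i) <? suc N ⌋ then b (F.suc i) else 0)
              ≡ (if ⌊ toℕ i <? N ⌋ then b (F.suc i) else 0)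
  shift i = cong (λ t → if t then b (F.suc i) else 0)
                 (⌊⌋-⇔ (mk⇔ s≤s⁻¹ s≤s) (suc (toℕ i) <? suc N) (toℕ i <? N))

boxStart-suc : ∀ {n} (b : Fin (suc n) → ℕ) (i : Fin n) →
  boxStart b (F.suc i) ≡ b F.zero + boxStart (b ∘ F.suc) i
boxStart-suc b i = prefixSum-suc b (toℕ i)

partition-ℕ : ∀ n (b : Fin n → ℕ) v → v < sumFin n b →
  count (λ i → inInterval (boxStart b i) (b i) v) ≡ 1
partition-ℕ (suc n) b v v<Σb with v <? b F.zero
... | yes v<b₀ = cong₂ _+_ (cong 𝟙 inFirst) (trans (count-cong notInRest) (sum-zero {n} (λ _ → refl)))
  where
  inFirst : inInterval (boxStart b F.zero) (b F.zero) v ≡ true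
  inFirst rewrite prefixSum-zero b = ⌊⌋-true (v <? b F.zero) v<b₀
  notInRest : ∀ i → inInterval (boxStart b (F.suc i)) (b (F.suc i)) v ≡ false
  notInRest i rewrite boxStart-suc b i = inInterval-below (boxStart (b ∘ F.suc) i) (b (F.suc i)) v<b₀
... | no v≮b₀ = cong₂ _+_ (cong 𝟙 notInFirst) (trans (count-cong inRest) (partition-ℕ n (b ∘ F.suc) w w<Σb′))
  where
  b₀≤v : b F.zero ≤ v
  b₀≤v = ≮⇒≥ v≮b₀
  w : ℕ
  w = v ∸ b F.zero
  v≡b₀+w : v ≡ b F.zero + w
  v≡b₀+w = sym (m+[n∸m]≡n b₀≤v)
  w<Σb′ : w < sumFin n (b ∘ F.suc)
  w<Σb′ = +-cancelˡ-< (b F.zero) w _ (subst (_< sumFin (suc n) b) v≡b₀+w v<Σb)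
  notInFirst : inInterval (boxStart b F.zero) (b F.zero) v ≡ false
  notInFirst rewrite prefixSum-zero b = cong (_ ∧_) (⌊⌋-false (v <? b F.zero) v≮b₀)
  inRest : ∀ i → inInterval (boxStart b (F.suc i)) (b (F.suc i)) v
               ≡ inInterval (boxStart (b ∘ F.suc) i) (b (F.suc i)) w
  inRest i = begin
    inInterval (boxStart b (F.suc i)) (b (F.suc i)) v
      ≡⟨ cong₂ (λ c → inInterval c (b (F.suc i))) (boxStart-suc b i) v≡b₀+w ⟩
    inInterval (b F.zero + boxStart (b ∘ F.suc) i) (b (F.suc i)) (b F.zero + w)
      ≡⟨ inInterval-shift (b F.zero) _ _ w ⟩
    inInterval (boxStart (b ∘ F.suc) i) (b (F.suc i)) w ∎
    where open ≡-Reasoning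

boxEnd≤ : ∀ n (b : Fin n → ℕ) (i : Fin n) → boxStart b i + b i ≤ sumFin n b
boxEnd≤ (suc n) b F.zero rewrite prefixSum-zero b = m≤m+n _ _
boxEnd≤ (suc n) b (F.suc i) rewrite boxStart-suc b i | +-assoc (b F.zero) (boxStart (b ∘ F.suc) i) (b (F.suc i)) =
  +-monoʳ-≤ (b F.zero) (boxEnd≤ n (b ∘ F.suc) i)

count-below : ∀ m h → h ≤ m → count {m} (λ x → ⌊ toℕ x <? h ⌋) ≡ h
count-below m zero _ =
  trans (count-cong {m} {λ x → ⌊ toℕ x <? 0 ⌋} {λ _ → false} (λ x → ⌊⌋-false (toℕ x <? 0) λ ()))
        (sum-zero {m} (λ _ → refl))
count-below (suc m) (suc h) h<m = cong₂ _+_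
  (cong 𝟙 (⌊⌋-true (0 <? suc h) (s≤s z≤n)))
  (trans (count-cong {m} {λ x → ⌊ suc (toℕ x) <? suc h ⌋}
           (λ x → ⌊⌋-⇔ (mk⇔ s≤s⁻¹ s≤s) (suc (toℕ x) <? suc h) (toℕ x <? h)))
         (count-below m h (s≤s⁻¹ h<m)))

count-interval : ∀ m c d → c + d ≤ m → count {m} (λ x → inInterval c d (toℕ x)) ≡ d
count-interval m c d c+d≤m = +-cancelˡ-≡ c _ _ (begin
  c + count {m} (λ x → inInterval c d (toℕ x))
      ≡⟨ cong₂ _+_ (trans (count-cong {m} lower) (count-below m c (≤-trans (m≤m+n c d) c+d≤m)))
                   (count-cong {m} upper) ⟨
  count (λ x → below (c + d) x ∧ below c x) + count (λ x → below (c + d) x ∧ not (below c x))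
      ≡⟨ count-split (below (c + d)) (below c) ⟨
  count (below (c + d))
      ≡⟨ count-below m (c + d) c+d≤m ⟩
  c + d ∎)
  where
  open ≡-Reasoning
  below : ℕ → Fin m → Bool
  below h x = ⌊ toℕ x <? h ⌋
  lower : ∀ x → (below (c + d) x ∧ below c x) ≡ below c x
  lower x with toℕ x <? c
  ... | yes v<c = cong (_∧ true) (⌊⌋-true (toℕ x <? c + d) (<-≤-trans v<c (m≤m+n c d)))
  ... | no  _   = ∧-zeroʳ _
  upper : ∀ x → (below (c + d) x ∧ not (below c x)) ≡ inInterval c d (toℕ x)
  upper x = trans (cong (below (c + d) x ∧_) (not-<? (toℕ x) c)) (∧-comm (below (c + d) x) ⌊ c ≤? toℕ x ⌋)

module Board {n : ℕ} (b : Fin n → ℕ) where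

  m : ℕ
  m = sumFin n b

  -- Box membership is kept opaque so that type checking never unfolds the
  -- interval tests; it is accessed through the two lemmas below.
  opaque
    inBox : Fin n → Fin m → Bool
    inBox i x = lookup (box b i) x

    ∈box⇒inBox : ∀ {i x} → x ∈ box b i → inBox i x ≡ true
    ∈box⇒inBox = []=⇒lookup

    inBox-interval : ∀ i x → inBox i x ≡ inInterval (boxStart b i) (b i) (toℕ x)
    inBox-interval i x = lookup∘tabulate _ x

  partition : ∀ x → count (λ i → inBox i x) ≡ 1
  partition x = trans (count-cong (λ i → inBox-interval i x)) (partition-ℕ n b (toℕ x) (FinP.toℕ<n x))

  boxSize : ∀ i → count (inBox i) ≡ b i
  boxSize i = trans (count-cong (inBox-interval i)) (count-interval m (boxStart b i) (b i) (boxEnd≤ n b i))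

  decompose : (P : Fin m → Bool) → count P ≡ sum (λ i → count (λ x → inBox i x ∧ P x))
  decompose P = trans (sum-cong-≗ spread) (∑-comm (λ x i → 𝟙 (inBox i x ∧ P x)))
    where
    𝟙-∧ : ∀ a c → 𝟙 c * 𝟙 a ≡ 𝟙 (a ∧ c)
    𝟙-∧ true  c     = *-identityʳ (𝟙 c)
    𝟙-∧ false true  = refl
    𝟙-∧ false false = refl
    spread : ∀ x → 𝟙 (P x) ≡ sum (λ i → 𝟙 (inBox i x ∧ P x))
    spread x = begin
      𝟙 (P x)                                ≡⟨ *-identityʳ (𝟙 (P x)) ⟨
      𝟙 (P x) * 1                            ≡⟨ cong (𝟙 (P x) *_) (partition x) ⟨
      𝟙 (P x) * count (λ i → inBox i x)      ≡⟨ *-distribˡ-sum (𝟙 (P x)) (λ i → 𝟙 (inBox i x)) ⟩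
      sum (λ i → 𝟙 (P x) * 𝟙 (inBox i x))    ≡⟨ sum-cong-≗ (λ i → 𝟙-∧ (inBox i x) (P x)) ⟩
      sum (λ i → 𝟙 (inBox i x ∧ P x))        ∎
      where open ≡-Reasoning

  boxOf : Fin m → Fin n
  boxOf x = proj₁ (count-witness (λ i → inBox i x) (≤-reflexive (sym (partition x))))

  boxOf-inBox : ∀ x → inBox (boxOf x) x ≡ true
  boxOf-inBox x = proj₂ (count-witness (λ i → inBox i x) (≤-reflexive (sym (partition x))))

  inBox⇒boxOf : ∀ i x → inBox i x ≡ true → boxOf x ≡ i
  inBox⇒boxOf i x x∈i = count-unique (λ j → inBox j x) (partition x) _ _ (boxOf-inBox x) x∈i

-- The arithmetic of Markov's inequality: with A = 2k+1, if A·B ≤ k·(A·M)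
-- and A·M ≤ c + B then M ≤ c.
markov-arith : ∀ k M c B → suc (k + k) * B ≤ k * (suc (k + k) * M) →
  suc (k + k) * M ≤ c + B → M ≤ c
markov-arith k M c B AB≤kAM AM≤c+B = +-cancelʳ-≤ (k * M) M c (≤-trans M+kM≤AM AM≤c+kM)
  where
  A : ℕ
  A = suc (k + k)
  open ≤-Reasoning
  AM≤c+kM : A * M ≤ c + k * M
  AM≤c+kM = *-cancelˡ-≤ A (begin
    A * (A * M)        ≤⟨ *-monoʳ-≤ A AM≤c+B ⟩
    A * (c + B)        ≡⟨ *-distribˡ-+ A c B ⟩
    A * c + A * B      ≤⟨ +-monoʳ-≤ (A * c) AB≤kAM ⟩
    A * c + k * (A * M) ≡⟨ factor k M c ⟩
    A * (c + k * M)    ∎)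
    where
    factor : ∀ k M c → suc (k + k) * c + k * (suc (k + k) * M) ≡ suc (k + k) * (c + k * M)
    factor = solve-∀
  M+kM≤AM : M + k * M ≤ A * M
  M+kM≤AM = ≤-trans (m≤m+n (M + k * M) (k * M)) (≤-reflexive (identity k M))
    where
    identity : ∀ k M → M + k * M + k * M ≡ suc (k + k) * M
    identity = solve-∀

many-small-boxes : ∀ k M n (b : Fin n → ℕ) → suc (k + k) * M ≤ n →
  prefixSum (suc (k + k) * M) b ≤ k * (suc (k + k) * M) →
  M ≤ count (λ i → ⌊ b i ≤? k + k ⌋)
many-small-boxes k M n b N≤n ΣbN≤kN = markov-arith k M (count small) (count largeFirst) AB≤kN N≤#small+#large
  where
  N : ℕ
  N = suc (k + k) * M
  first small : Fin n → Bool
  first i = ⌊ toℕ i <? N ⌋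
  small i = ⌊ b i ≤? k + k ⌋
  largeFirst : Fin n → Bool
  largeFirst i = first i ∧ not (small i)
  -- every large box among the first N has at least 2k+1 elements
  weigh : ∀ i → suc (k + k) * 𝟙 (largeFirst i) ≤ (if first i then b i else 0)
  weigh i with first i | small i in smallᵢ
  ... | false | _     = ≤-reflexive (*-zeroʳ (suc (k + k)))
  ... | true  | true  = ≤-trans (≤-reflexive (*-zeroʳ (suc (k + k)))) z≤n
  ... | true  | false = ≤-trans (≤-reflexive (*-identityʳ _)) (≰⇒> (⌊⌋⇒¬ (b i ≤? k + k) smallᵢ))
  AB≤kN : suc (k + k) * count largeFirst ≤ k * N
  AB≤kN = ≤-trans (≤-reflexive (*-distribˡ-sum (suc (k + k)) (𝟙 ∘ largeFirst)))
         (≤-trans (sum-mono weigh) (≤-trans (≤-reflexive (sym (sumFin≡sum n _))) ΣbN≤kN))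
  N≤#small+#large : N ≤ count small + count largeFirst
  N≤#small+#large = begin
    N                                                         ≡⟨ count-below n N N≤n ⟨
    count first                                               ≡⟨ count-split first small ⟩
    count (λ i → first i ∧ small i) + count largeFirst
                          ≤⟨ +-monoˡ-≤ _ (count-mono (λ i → proj₂ ∘ ∧-true (first i))) ⟩
    count small + count largeFirst                            ∎
    where open ≤-Reasoning

-- In phase u of the strategy every live box has at most p + 1 + u free
-- cells.  G u is the number of live boxes needed to enter phase u, and
-- minLive u the number of live boxes guaranteed throughout phase u.
module Thresholds (p q : ℕ) (hp : 1 ≤ p) where

  G : ℕ → ℕ
  G zero    = suc q
  G (suc u) = (1 + q * suc u) * (G u + q)

  minLive : ℕ → ℕ
  minLive zero    = suc q
  minLive (suc u) = G u + q

  G≥1 : ∀ u → 1 ≤ G u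
  G≥1 zero    = s≤s z≤n
  G≥1 (suc u) = ≤-trans (≤-trans (G≥1 u) (m≤m+n (G u) q)) (m≤m+n (G u + q) (q * suc u * (G u + q)))

  minLive≥ : ∀ u → suc q ≤ minLive u
  minLive≥ zero    = ≤-refl
  minLive≥ (suc u) = +-monoˡ-≤ q (G≥1 u)

  -- The potential inequality p·L₀ + q·Z ≤ (p + q·u)·L, with L₀ ≥ G u the
  -- number of live boxes at the start of the phase, keeps L ≥ minLive u.
  minLive-bound : ∀ u L₀ L Z → G u ≤ L₀ → p * L₀ + q * Z ≤ (p + q * u) * L → minLive u ≤ L
  minLive-bound zero L₀ L Z G≤L₀ pot = ≤-trans G≤L₀ (*-cancelˡ-≤ p {{>-nonZero hp}} (begin
    p * L₀           ≤⟨ m≤m+n (p * L₀) (q * Z) ⟩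
    p * L₀ + q * Z   ≤⟨ pot ⟩
    (p + q * 0) * L  ≡⟨ cong (λ e → (p + e) * L) (*-zeroʳ q) ⟩
    (p + 0) * L      ≡⟨ cong (_* L) (+-identityʳ p) ⟩
    p * L            ∎))
    where open ≤-Reasoning
  minLive-bound (suc u) L₀ L Z G≤L₀ pot = *-cancelˡ-≤ (p + q * suc u) {{nonZero}} (begin
    (p + q * suc u) * (G u + q)          ≤⟨ *-monoˡ-≤ (G u + q) p+qs≤p[1+qs] ⟩
    p * (1 + q * suc u) * (G u + q)      ≡⟨ *-assoc p _ _ ⟩
    p * G (suc u)                        ≤⟨ *-monoʳ-≤ p G≤L₀ ⟩
    p * L₀                               ≤⟨ m≤m+n (p * L₀) (q * Z) ⟩
    p * L₀ + q * Z                       ≤⟨ pot ⟩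
    (p + q * suc u) * L                  ∎)
    where
    open ≤-Reasoning
    nonZero : NonZero (p + q * suc u)
    nonZero = >-nonZero (≤-trans hp (m≤m+n p _))
    p+qs≤p[1+qs] : p + q * suc u ≤ p * (1 + q * suc u)
    p+qs≤p[1+qs] = ≤-trans (+-monoʳ-≤ p (m≤n*m (q * suc u) p {{>-nonZero hp}}))
                           (≤-reflexive (sym (trans (*-distribˡ-+ p 1 (q * suc u))
                                                    (cong (_+ p * (q * suc u)) (*-identityʳ p)))))

-- A round of phase u (Avoider claims c ≥ p cells, all of which reduce the
-- excess Z; Enforcer then kills q boxes of excess s) preserves the potential.
potential-step : ∀ p q s L₀ Z L c → p ≤ c →
  p * L₀ + q * ((Z + s * q) + c) ≤ (p + q * s) * (L + q) →
  p * L₀ + q * Z ≤ (p + q * s) * L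
potential-step p q s L₀ Z L c p≤c pot = +-cancelʳ-≤ (p * q + q * (s * q)) _ _ (begin
  p * L₀ + q * Z + (p * q + q * (s * q))  ≤⟨ +-monoʳ-≤ (p * L₀ + q * Z) (+-monoˡ-≤ (q * (s * q)) pq≤qc) ⟩
  p * L₀ + q * Z + (q * c + q * (s * q))  ≡⟨ regroup p q s L₀ Z c ⟩
  p * L₀ + q * ((Z + s * q) + c)          ≤⟨ pot ⟩
  (p + q * s) * (L + q)                   ≡⟨ expand p q s L ⟩
  (p + q * s) * L + (p * q + q * (s * q)) ∎)
  where
  open ≤-Reasoning
  pq≤qc : p * q ≤ q * c
  pq≤qc = ≤-trans (≤-reflexive (*-comm p q)) (*-monoʳ-≤ q p≤c)
  regroup : ∀ p q s L₀ Z c → p * L₀ + q * Z + (q * c + q * (s * q)) ≡ p * L₀ + q * ((Z + s * q) + c)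
  regroup = solve-∀
  expand : ∀ p q s L → (p + q * s) * (L + q) ≡ (p + q * s) * L + (p * q + q * (s * q))
  expand = solve-∀

-- At the start of a phase (L₀ = L) the potential holds as soon as every
-- live box has excess at most u.
potential-fresh : ∀ p q u L Z → Z ≤ u * L → p * L + q * Z ≤ (p + q * u) * L
potential-fresh p q u L Z Z≤uL = ≤-trans (+-monoʳ-≤ (p * L) (*-monoʳ-≤ q Z≤uL)) (≤-reflexive (distrib p q u L))
  where
  distrib : ∀ p q u L → p * L + q * (u * L) ≡ (p + q * u) * L
  distrib = solve-∀

module BoxGame (p q : ℕ) (hp : 1 ≤ p) (hq : 1 ≤ q) {n : ℕ} (b : Fin n → ℕ) where
  open Board b public

  Win : Player → Position m → Set
  Win = EnforcerWins p q (box b)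

  isFree : Owner → Bool
  isFree free     = true
  isFree avoider  = false
  isFree enforcer = false

  isFree⇒ : ∀ {o} → isFree o ≡ true → o ≡ free
  isFree⇒ {free} _ = refl

  unclaimed : Position m → Fin m → Bool
  unclaimed pos x = isFree (lookup pos x)

  #free : Position m → ℕ
  #free pos = count (unclaimed pos)

  freeIn : Position m → Fin n → ℕ
  freeIn pos i = count (λ x → inBox i x ∧ unclaimed pos x)

  _⊆free_ : Subset m → Position m → Set
  S ⊆free pos = lookup S ⊆ᵇ unclaimed pos

  legal⇒⊆free : ∀ {r} pos S → Legal r pos S → S ⊆free pos
  legal⇒⊆free pos S (S⊆free , _) x x∈S = cong isFree (S⊆free x (lookup⇒[]= x S x∈S))

  lookup-claim : ∀ o (S : Subset m) (pos : Position m) x →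
    lookup (claim o S pos) x ≡ (if lookup S x then o else lookup pos x)
  lookup-claim o S pos x = lookup∘tabulate (λ y → if lookup S y then o else lookup pos y) x

  unclaimed-claim : ∀ {o} → isFree o ≡ false → ∀ (S : Subset m) pos x →
    unclaimed (claim o S pos) x ≡ unclaimed pos x ∧ not (lookup S x)
  unclaimed-claim {o} o≠free S pos x = trans (cong isFree (lookup-claim o S pos x)) (byCase (lookup S x))
    where
    byCase : ∀ s → isFree (if s then o else lookup pos x) ≡ unclaimed pos x ∧ not s
    byCase true  = trans o≠free (sym (∧-zeroʳ _))
    byCase false = sym (∧-identityʳ _)

  claim-split : ∀ {o} → isFree o ≡ false → ∀ pos S → S ⊆free pos → (R : Fin m → Bool) →
    count (λ x → R x ∧ unclaimed pos x)
      ≡ count (λ x → R x ∧ unclaimed (claim o S pos) x) + count (λ x → R x ∧ lookup S x)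
  claim-split o≠free pos S S⊆free R =
    trans (sum-cong-≗ split) (∑-distrib-+ (λ x → 𝟙 (R x ∧ unclaimed (claim _ S pos) x)) _)
    where
    split : ∀ x → 𝟙 (R x ∧ unclaimed pos x)
                ≡ 𝟙 (R x ∧ unclaimed (claim _ S pos) x) + 𝟙 (R x ∧ lookup S x)
    split x = subst (λ v → 𝟙 (R x ∧ unclaimed pos x) ≡ 𝟙 (R x ∧ v) + 𝟙 (R x ∧ lookup S x))
                    (sym (unclaimed-claim o≠free S pos x))
                    (values (R x) (unclaimed pos x) (lookup S x) (S⊆free x))
      where
      values : ∀ r u s → (s ≡ true → u ≡ true) → 𝟙 (r ∧ u) ≡ 𝟙 (r ∧ (u ∧ not s)) + 𝟙 (r ∧ s)
      values false _     _     _   = refl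
      values true  true  true  _   = refl
      values true  true  false _   = refl
      values true  false false _   = refl
      values true  false true  s⇒u with () ← s⇒u refl

  #free-claim : ∀ {o} → isFree o ≡ false → ∀ pos S → S ⊆free pos →
    #free pos ≡ #free (claim o S pos) + count (lookup S)
  #free-claim o≠free pos S S⊆free = claim-split o≠free pos S S⊆free (λ _ → true)

  freeIn-claim : ∀ {o} → isFree o ≡ false → ∀ pos S → S ⊆free pos → ∀ i →
    freeIn pos i ≡ freeIn (claim o S pos) i + count (λ x → inBox i x ∧ lookup S x)
  freeIn-claim o≠free pos S S⊆free i = claim-split o≠free pos S S⊆free (inBox i)

  freeIn-claim≤ : ∀ {o} → isFree o ≡ false → ∀ pos S → S ⊆free pos → ∀ i →
    freeIn (claim o S pos) i ≤ freeIn pos i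
  freeIn-claim≤ o≠free pos S S⊆free i =
    ≤-trans (m≤m+n _ _) (≤-reflexive (sym (freeIn-claim o≠free pos S S⊆free i)))

  #free≡∑freeIn : ∀ pos → #free pos ≡ sum (freeIn pos)
  #free≡∑freeIn pos = decompose (unclaimed pos)

  freeIn≤#free : ∀ pos i → freeIn pos i ≤ #free pos
  freeIn≤#free pos i = ≤-trans (term≤sum (freeIn pos) i) (≤-reflexive (sym (#free≡∑freeIn pos)))

  #free≡0⇒over : ∀ pos → #free pos ≡ 0 → IsOver pos
  #free≡0⇒over pos #free≡0 x x-free with count-zero (unclaimed pos) #free≡0 x
  ... | not-free rewrite x-free with not-free
  ... | ()

  notOver : ∀ pos → 1 ≤ #free pos → ¬ IsOver pos
  notOver pos 1≤#free over with count-witness (unclaimed pos) 1≤#free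
  ... | x , x-free = over x (isFree⇒ x-free)

  over⇒freeIn≡0 : ∀ pos → IsOver pos → ∀ i → freeIn pos i ≡ 0
  over⇒freeIn≡0 pos over i = trans (count-cong noneFree) (sum-zero {m} (λ _ → refl))
    where
    noneFree : ∀ x → (inBox i x ∧ unclaimed pos x) ≡ false
    noneFree x with lookup pos x in e
    ... | free     = ⊥-elim (over x e)
    ... | avoider  = ∧-zeroʳ (inBox i x)
    ... | enforcer = ∧-zeroʳ (inBox i x)

  filledByAvoider : ∀ pos i → freeIn pos i ≡ 0 →
    (∀ x → inBox i x ≡ true → ¬ lookup pos x ≡ enforcer) → AvoiderLost (box b) pos
  filledByAvoider pos i noFree noEnforcer = i , λ x x∈i → owner x (∈box⇒inBox x∈i)
    where
    owner : ∀ x → inBox i x ≡ true → lookup pos x ≡ avoider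
    owner x x∈i with lookup pos x in e
                   | subst (λ a → (a ∧ unclaimed pos x) ≡ false) x∈i (count-zero _ noFree x)
    ... | avoider  | _ = refl
    ... | enforcer | _ = ⊥-elim (noEnforcer x x∈i e)
    ... | free     | ()

  lost-persists : ∀ o pos S → S ⊆free pos → AvoiderLost (box b) pos → AvoiderLost (box b) (claim o S pos)
  lost-persists o pos S S⊆free (j , filled) = j , λ x x∈j → stillAvoider x (filled x x∈j)
    where
    stillAvoider : ∀ x → lookup pos x ≡ avoider → lookup (claim o S pos) x ≡ avoider
    stillAvoider x owned rewrite lookup-claim o S pos x with lookup S x in x∈S
    ... | false = owned
    ... | true  with () ← trans (sym (cong isFree owned)) (S⊆free x x∈S)

  Covers : Subset m → Position m → Set
  Covers S pos = unclaimed pos ⊆ᵇ lookup S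

  covering⇒over : ∀ {o} → isFree o ≡ false → ∀ pos S → Covers S pos → IsOver (claim o S pos)
  covering⇒over o≠free pos S covers x x-free = noneLeft (unclaimed pos x) (lookup S x) (covers x) freeAfter
    where
    freeAfter : (unclaimed pos x ∧ not (lookup S x)) ≡ true
    freeAfter = trans (sym (unclaimed-claim o≠free S pos x)) (cong isFree x-free)
    noneLeft : ∀ u s → (u ≡ true → s ≡ true) → (u ∧ not s) ≡ true → ⊥
    noneLeft true s u⇒s u∧¬s with () ← trans (sym (cong not (u⇒s refl))) u∧¬s

  legal-covers : ∀ {r} pos S → Legal r pos S → #free pos ≤ r → Covers S pos
  legal-covers pos S (S⊆free , inj₁ r≤∣S∣) #free≤r =
    count-saturate (legal⇒⊆free pos S (S⊆free , inj₁ r≤∣S∣))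
                   (≤-trans #free≤r (≤-trans r≤∣S∣ (≤-reflexive (∣∣≡count S))))
  legal-covers pos S (_ , inj₂ takesAll) _ x x-free = []=⇒lookup (takesAll x (isFree⇒ x-free))

  allFree : Position m → Subset m
  allFree pos = tabulate (unclaimed pos)

  lookup-allFree : ∀ pos x → lookup (allFree pos) x ≡ unclaimed pos x
  lookup-allFree pos x = lookup∘tabulate (unclaimed pos) x

  allFree-legal : ∀ r pos → Legal r pos (allFree pos)
  allFree-legal r pos =
      (λ x x∈S → isFree⇒ (trans (sym (lookup-allFree pos x)) ([]=⇒lookup x∈S)))
    , inj₂ (λ x x-free → lookup⇒[]= x (allFree pos) (trans (lookup-allFree pos x) (cong isFree x-free)))

  allFree-covers : ∀ pos → Covers (allFree pos) pos
  allFree-covers pos x x-free = trans (lookup-allFree pos x) x-free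

  lost⇒win : ∀ pos → AvoiderLost (box b) pos → Win Enforcer pos
  lost⇒win pos lost with #free pos in e
  ... | zero  = done (#free≡0⇒over pos e) lost
  ... | suc _ = enfMove (notOver pos (subst (1 ≤_) (sym e) (s≤s z≤n))) (allFree pos) legal
                  (done (covering⇒over refl pos (allFree pos) (allFree-covers pos))
                        (lost-persists enforcer pos (allFree pos) (legal⇒⊆free pos (allFree pos) legal) lost))
    where
    legal = allFree-legal q pos

  live : Position m → Fin n → Bool
  live pos i = ⌊ 1 ≤? freeIn pos i ⌋

  live⇒ : ∀ pos i → live pos i ≡ true → 1 ≤ freeIn pos i
  live⇒ pos i = ⌊⌋⇒ (1 ≤? freeIn pos i)

  ⇒live : ∀ pos i → 1 ≤ freeIn pos i → live pos i ≡ true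
  ⇒live pos i = ⌊⌋-true (1 ≤? freeIn pos i)

  #live : Position m → ℕ
  #live pos = count (live pos)

  -- Enforcer's invariant: a box in which Enforcer owns a cell has no free
  -- cell left.  So Enforcer never wastes a move, and a live box can still
  -- be filled by Avoider.
  Clean : Position m → Set
  Clean pos = ∀ i x → inBox i x ≡ true → lookup pos x ≡ enforcer → freeIn pos i ≡ 0

  clean-live : ∀ pos → Clean pos → ∀ i x → 1 ≤ freeIn pos i → inBox i x ≡ true →
    ¬ lookup pos x ≡ enforcer
  clean-live pos clean i x 1≤free x∈i owned = 1+n≰n (subst (1 ≤_) (clean i x x∈i owned) 1≤free)

  enforcer-before : ∀ pos S x → lookup (claim avoider S pos) x ≡ enforcer → lookup pos x ≡ enforcer
  enforcer-before pos S x owned with lookup S x in x∈S | lookup-claim avoider S pos x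
  ... | true  | after with () ← trans (sym after) owned
  ... | false | after = trans (sym after) owned

  clean-avoider : ∀ pos S → S ⊆free pos → Clean pos → Clean (claim avoider S pos)
  clean-avoider pos S S⊆free clean i x x∈i owned = n≤0⇒n≡0
    (≤-trans (freeIn-claim≤ refl pos S S⊆free i) (≤-reflexive (clean i x x∈i (enforcer-before pos S x owned))))

  killSet : (Fin n → Bool) → Position m → Subset m
  killSet J pos = tabulate (λ x → unclaimed pos x ∧ J (boxOf x))

  kill : (Fin n → Bool) → Position m → Position m
  kill J pos = claim enforcer (killSet J pos) pos

  lookup-killSet : ∀ J pos x → lookup (killSet J pos) x ≡ unclaimed pos x ∧ J (boxOf x)
  lookup-killSet J pos x = lookup∘tabulate (λ y → unclaimed pos y ∧ J (boxOf y)) x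

  killSet-⊆free : ∀ J pos → killSet J pos ⊆free pos
  killSet-⊆free J pos x x∈S = proj₁ (∧-true _ (trans (sym (lookup-killSet J pos x)) x∈S))

  unclaimed-kill : ∀ J pos x → unclaimed (kill J pos) x ≡ unclaimed pos x ∧ not (J (boxOf x))
  unclaimed-kill J pos x = trans (unclaimed-claim refl (killSet J pos) pos x)
    (trans (cong (λ s → unclaimed pos x ∧ not s) (lookup-killSet J pos x)) (absorb (unclaimed pos x) _))
    where
    absorb : ∀ a c → (a ∧ not (a ∧ c)) ≡ (a ∧ not c)
    absorb true  c = refl
    absorb false c = refl

  inBox-boxOf : ∀ i x (g : Fin n → Bool) a → (inBox i x ∧ (a ∧ g (boxOf x))) ≡ ((inBox i x ∧ a) ∧ g i)
  inBox-boxOf i x g a with inBox i x in x∈i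
  ... | false = refl
  ... | true  rewrite inBox⇒boxOf i x x∈i = refl

  freeIn-kill : ∀ J pos i → freeIn (kill J pos) i ≡ (if J i then 0 else freeIn pos i)
  freeIn-kill J pos i = begin
    freeIn (kill J pos) i
      ≡⟨ count-cong (λ x → trans (cong (inBox i x ∧_) (unclaimed-kill J pos x)) (inBox-boxOf i x (not ∘ J) _)) ⟩
    count (λ x → (inBox i x ∧ unclaimed pos x) ∧ not (J i))
      ≡⟨ count-∧-const (λ x → inBox i x ∧ unclaimed pos x) (not (J i)) ⟩
    (if not (J i) then freeIn pos i else 0)
      ≡⟨ if-not (J i) ⟩
    (if J i then 0 else freeIn pos i) ∎
    where
    open ≡-Reasoning
    if-not : ∀ c → (if not c then freeIn pos i else 0) ≡ (if c then 0 else freeIn pos i)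
    if-not true  = refl
    if-not false = refl

  ∣killSet∣ : ∀ J pos → ∣ killSet J pos ∣ ≡ sum (λ i → if J i then freeIn pos i else 0)
  ∣killSet∣ J pos = begin
    ∣ killSet J pos ∣
      ≡⟨ trans (∣∣≡count (killSet J pos)) (count-cong (lookup-killSet J pos)) ⟩
    count (λ x → unclaimed pos x ∧ J (boxOf x))
      ≡⟨ decompose _ ⟩
    sum (λ i → count (λ x → inBox i x ∧ (unclaimed pos x ∧ J (boxOf x))))
      ≡⟨ sum-cong-≗ (λ i → trans (count-cong (λ x → inBox-boxOf i x J _))
                                 (count-∧-const (λ x → inBox i x ∧ unclaimed pos x) (J i))) ⟩
    sum (λ i → if J i then freeIn pos i else 0) ∎
    where open ≡-Reasoning

  #free-kill≤ : ∀ J pos → #free (kill J pos) ≤ #free pos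
  #free-kill≤ J pos =
    ≤-trans (m≤m+n _ _) (≤-reflexive (sym (#free-claim refl pos (killSet J pos) (killSet-⊆free J pos))))

  freeIn-kill≤ : ∀ J pos i → freeIn (kill J pos) i ≤ freeIn pos i
  freeIn-kill≤ J pos i = freeIn-claim≤ refl pos (killSet J pos) (killSet-⊆free J pos) i

  clean-kill : ∀ J pos → Clean pos → Clean (kill J pos)
  clean-kill J pos clean i x x∈i owned
    with lookup (killSet J pos) x in x∈S | lookup-claim enforcer (killSet J pos) pos x
  ... | false | after =
    n≤0⇒n≡0 (≤-trans (freeIn-kill≤ J pos i) (≤-reflexive (clean i x x∈i (trans (sym after) owned))))
  ... | true  | _     = trans (freeIn-kill J pos i) (cong (λ c → if c then 0 else freeIn pos i) Ji)
    where
    Ji : J i ≡ true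
    Ji = subst (λ j → J j ≡ true) (inBox⇒boxOf i x x∈i)
               (proj₂ (∧-true _ (trans (sym (lookup-killSet J pos x)) x∈S)))

  #live-kill : ∀ J pos → J ⊆ᵇ live pos → #live pos ≡ #live (kill J pos) + count J
  #live-kill J pos J⊆live = trans (sum-cong-≗ split) (∑-distrib-+ (𝟙 ∘ live (kill J pos)) (𝟙 ∘ J))
    where
    split : ∀ i → 𝟙 (live pos i) ≡ 𝟙 (live (kill J pos) i) + 𝟙 (J i)
    split i rewrite freeIn-kill J pos i with J i in Ji
    ... | true  rewrite J⊆live i Ji = refl
    ... | false = sym (+-identityʳ _)

  -- The excess: free cells beyond p + 1, summed over the boxes (the Z of
  -- the potential).
  excess : Position m → ℕ
  excess pos = sum (λ i → freeIn pos i ∸ suc p)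

  excess-kill : ∀ J pos →
    excess pos ≡ excess (kill J pos) + sum (λ i → if J i then freeIn pos i ∸ suc p else 0)
  excess-kill J pos = trans (sum-cong-≗ split) (∑-distrib-+ (λ i → freeIn (kill J pos) i ∸ suc p) _)
    where
    split : ∀ i → freeIn pos i ∸ suc p
                ≡ (freeIn (kill J pos) i ∸ suc p) + (if J i then freeIn pos i ∸ suc p else 0)
    split i rewrite freeIn-kill J pos i with J i
    ... | true  = refl
    ... | false = sym (+-identityʳ _)

  killMove : ∀ J pos → q ≤ ∣ killSet J pos ∣ → Win Avoider (kill J pos) → Win Enforcer pos
  killMove J pos q≤∣S∣ next = enfMove (notOver pos 1≤#free) (killSet J pos) legal next
    where
    legal : Legal q pos (killSet J pos)
    legal = (λ x x∈S → isFree⇒ (killSet-⊆free J pos x ([]=⇒lookup x∈S))) , inj₁ q≤∣S∣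
    1≤#free : 1 ≤ #free pos
    1≤#free = ≤-trans (≤-trans hq q≤∣S∣)
                (≤-trans (≤-reflexive (∣∣≡count (killSet J pos))) (count-mono (killSet-⊆free J pos)))

  #J≤∣killSet∣ : ∀ J pos → J ⊆ᵇ live pos → count J ≤ ∣ killSet J pos ∣
  #J≤∣killSet∣ J pos J⊆live = ≤-trans (sum-mono atLeastOne) (≤-reflexive (sym (∣killSet∣ J pos)))
    where
    atLeastOne : ∀ i → 𝟙 (J i) ≤ (if J i then freeIn pos i else 0)
    atLeastOne i with J i in Ji
    ... | true  = live⇒ pos i (J⊆live i Ji)
    ... | false = z≤n

  killLive : ∀ J pos → J ⊆ᵇ live pos → q ≤ count J → Win Avoider (kill J pos) → Win Enforcer pos
  killLive J pos J⊆live q≤#J = killMove J pos (≤-trans q≤#J (#J≤∣killSet∣ J pos J⊆live))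

  -- Avoider to move, in a clean position with a live box and at most p
  -- free cells, has to claim them all and so fills that box.
  forcedFill : ∀ pos i → Clean pos → 1 ≤ freeIn pos i → #free pos ≤ p → Win Avoider pos
  forcedFill pos i clean 1≤free #free≤p = avoMove (notOver pos (≤-trans 1≤free (freeIn≤#free pos i))) lastMove
    where
    lastMove : ∀ S → Legal p pos S → Win Enforcer (claim avoider S pos)
    lastMove S legal = done over (filledByAvoider after i (over⇒freeIn≡0 after over i) noEnforcer)
      where
      after : Position m
      after = claim avoider S pos
      over : IsOver after
      over = covering⇒over refl pos S (legal-covers pos S legal #free≤p)
      noEnforcer : ∀ x → inBox i x ≡ true → ¬ lookup (claim avoider S pos) x ≡ enforcer
      noEnforcer x x∈i owned = clean-live pos clean i x 1≤free x∈i (enforcer-before pos S x owned)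

  others : Fin n → Fin n → Bool
  others i j = not ⌊ j F.≟ i ⌋

  -- Enforcer to move, in a clean position with a live box i having at most
  -- p free cells and at least q free cells outside it, claims everything
  -- outside box i and forces Avoider to fill it.
  finishingBlow : ∀ pos i → Clean pos → 1 ≤ freeIn pos i → freeIn pos i ≤ p →
    q + freeIn pos i ≤ #free pos → Win Enforcer pos
  finishingBlow pos i clean 1≤free free≤p q+free≤#free =
    killMove (others i) pos q≤∣S∣ (forcedFill rest i (clean-kill (others i) pos clean)
      (subst (1 ≤_) (sym keep-i) 1≤free) (subst (_≤ p) (sym #free-rest) free≤p))
    where
    S : Subset m
    S = killSet (others i) pos
    rest : Position m
    rest = kill (others i) pos
    keep-i : freeIn rest i ≡ freeIn pos i
    keep-i = trans (freeIn-kill (others i) pos i)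
                   (cong (λ c → if not c then 0 else freeIn pos i) (⌊⌋-true (i F.≟ i) refl))
    #free-rest : #free rest ≡ freeIn pos i
    #free-rest = trans (#free≡∑freeIn rest) (trans (sum-supported (freeIn rest) i emptied) keep-i)
      where
      emptied : ∀ j → j ≢ i → freeIn rest j ≡ 0
      emptied j j≢i = trans (freeIn-kill (others i) pos j)
                            (cong (λ c → if not c then 0 else freeIn pos j) (⌊⌋-false (j F.≟ i) j≢i))
    q≤∣S∣ : q ≤ ∣ killSet (others i) pos ∣
    q≤∣S∣ = +-cancelʳ-≤ (freeIn pos i) q _ (begin
      q + freeIn pos i                                     ≤⟨ q+free≤#free ⟩
      #free pos                                            ≡⟨ #free-claim refl pos S (killSet-⊆free (others i) pos) ⟩
      #free rest + count (lookup S)                        ≡⟨ cong₂ _+_ (sym #free-rest) (∣∣≡count S) ⟨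
      freeIn pos i + ∣ killSet (others i) pos ∣            ≡⟨ +-comm (freeIn pos i) _ ⟩
      ∣ killSet (others i) pos ∣ + freeIn pos i            ∎)
      where open ≤-Reasoning

  dead⇒empty : ∀ pos i → live pos i ≡ false → freeIn pos i ≡ 0
  dead⇒empty pos i dead = n<1⇒n≡0 (≰⇒> (⌊⌋⇒¬ (1 ≤? freeIn pos i) dead))

  fillsOrKeepsLive : ∀ pos S → Clean pos → S ⊆free pos →
    Win Enforcer (claim avoider S pos) ⊎ live pos ⊆ᵇ live (claim avoider S pos)
  fillsOrKeepsLive pos S clean S⊆free
    with FinP.any? (λ i → (live pos i ∧ not (live (claim avoider S pos) i)) ≟ᵇ true)
  ... | yes (i , killed) =
    inj₁ (lost⇒win after (filledByAvoider after i (dead⇒empty after i nowDead) noEnforcer))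
    where
    after : Position m
    after = claim avoider S pos
    wasLive : live pos i ≡ true
    wasLive = proj₁ (∧-true (live pos i) killed)
    nowDead : live after i ≡ false
    nowDead with live after i | proj₂ (∧-true (live pos i) killed)
    ... | false | _ = refl
    noEnforcer : ∀ x → inBox i x ≡ true → ¬ lookup after x ≡ enforcer
    noEnforcer x x∈i owned = clean-live pos clean i x (live⇒ pos i wasLive) x∈i (enforcer-before pos S x owned)
  ... | no noneKilled = inj₂ stillLive
    where
    stillLive : live pos ⊆ᵇ live (claim avoider S pos)
    stillLive i wasLive with live (claim avoider S pos) i in now
    ... | true  = refl
    ... | false = ⊥-elim (noneKilled (i , cong₂ _∧_ wasLive (cong not now)))

  Calm : Position m → Subset m → Set
  Calm pos S = ∀ i → live pos i ≡ true → suc p ≤ freeIn (claim avoider S pos) i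

  roomOutside : ∀ pos pos′ i → live pos ⊆ᵇ live pos′ → live pos i ≡ true → suc q ≤ #live pos →
    q + freeIn pos′ i ≤ #free pos′
  roomOutside pos pos′ i stillLive wasLive q<#live = s≤s⁻¹ (begin
    suc q + freeIn pos′ i                 ≤⟨ +-monoˡ-≤ (freeIn pos′ i) q<#live ⟩
    #live pos + freeIn pos′ i             ≤⟨ sum-drop-mono oneEach i ⟩
    𝟙 (live pos i) + sum (freeIn pos′)    ≡⟨ cong₂ _+_ (cong 𝟙 wasLive) (sym (#free≡∑freeIn pos′)) ⟩
    suc (#free pos′)                      ∎)
    where
    open ≤-Reasoning
    oneEach : ∀ j → 𝟙 (live pos j) ≤ freeIn pos′ j
    oneEach j with live pos j in isLive
    ... | true  = live⇒ pos′ j (stillLive j isLive)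
    ... | false = z≤n

  avoiderMove : ∀ pos S → Clean pos → suc q ≤ #live pos → Legal p pos S →
    Win Enforcer (claim avoider S pos) ⊎ Calm pos S
  avoiderMove pos S clean q<#live legal with fillsOrKeepsLive pos S clean (legal⇒⊆free pos S legal)
  ... | inj₁ win = inj₁ win
  ... | inj₂ stillLive with FinP.any? (λ i → (live pos i ∧ ⌊ freeIn (claim avoider S pos) i ≤? p ⌋) ≟ᵇ true)
  ...   | yes (i , low) = inj₁ (finishingBlow after i (clean-avoider pos S (legal⇒⊆free pos S legal) clean)
                              (live⇒ after i (stillLive i wasLive)) (⌊⌋⇒ (freeIn after i ≤? p) atMostP)
                              (roomOutside pos after i stillLive wasLive q<#live))
    where
    after : Position m
    after = claim avoider S pos
    wasLive : live pos i ≡ true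
    wasLive = proj₁ (∧-true (live pos i) low)
    atMostP : ⌊ freeIn after i ≤? p ⌋ ≡ true
    atMostP = proj₂ (∧-true (live pos i) low)
  ...   | no noneLow = inj₂ calm
    where
    calm : Calm pos S
    calm i wasLive = ≰⇒> (λ atMostP →
      noneLow (i , cong₂ _∧_ wasLive (⌊⌋-true (freeIn (claim avoider S pos) i ≤? p) atMostP)))

  above : ℕ → Position m → Fin n → Bool
  above t pos i = ⌊ t <? freeIn pos i ⌋

  within : ℕ → Position m → Fin n → Bool
  within t pos i = live pos i ∧ not (above t pos i)

  above⊆live : ∀ t pos → above t pos ⊆ᵇ live pos
  above⊆live t pos i isAbove = ⇒live pos i (≤-trans (s≤s z≤n) (⌊⌋⇒ (t <? freeIn pos i) isAbove))

  #live-split : ∀ t pos → #live pos ≡ count (above t pos) + count (within t pos)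
  #live-split t pos =
    trans (count-split (live pos) (above t pos)) (cong (_+ count (within t pos)) (count-cong liveAbove))
    where
    liveAbove : ∀ i → (live pos i ∧ above t pos i) ≡ above t pos i
    liveAbove i with above t pos i in isAbove
    ... | true  = trans (∧-identityʳ _) (above⊆live t pos i isAbove)
    ... | false = ∧-zeroʳ _

  trim : ℕ → ℕ → Position m → Fin n → Bool
  trim t r pos i = above t pos i ∨ takeFirst r (within t pos) i

  trim⊆live : ∀ t r pos → trim t r pos ⊆ᵇ live pos
  trim⊆live t r pos i trimmed with above t pos i in isAbove
  ... | true  = above⊆live t pos i isAbove
  ... | false = proj₁ (∧-true _ (takeFirst-⊆ r (within t pos) i trimmed))

  #trim : ∀ t r pos → r ≤ count (within t pos) → count (trim t r pos) ≡ count (above t pos) + r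
  #trim t r pos = count-∪-takeFirst (above t pos) (within t pos) r notWithin
    where
    notWithin : ∀ i → above t pos i ≡ true → within t pos i ≡ false
    notWithin i isAbove rewrite isAbove = ∧-zeroʳ (live pos i)

  trim-bounded : ∀ t r pos i → freeIn (kill (trim t r pos) pos) i ≤ t
  trim-bounded t r pos i =
    subst (_≤ t) (sym (freeIn-kill (trim t r pos) pos i)) (bound (trim t r pos i) refl)
    where
    ∨-false : ∀ a {c} → (a ∨ c) ≡ false → a ≡ false
    ∨-false false _ = refl
    bound : ∀ c → trim t r pos i ≡ c → (if c then 0 else freeIn pos i) ≤ t
    bound true  _          = z≤n
    bound false notTrimmed = ≮⇒≥ (⌊⌋⇒¬ (t <? freeIn pos i) (∨-false (above t pos i) notTrimmed))

  open Thresholds p q hp public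

  record Phase (u L₀ : ℕ) (pos : Position m) : Set where
    field
      clean     : Clean pos
      bounded   : ∀ i → freeIn pos i ≤ suc p + u
      enough    : G u ≤ L₀
      potential : p * L₀ + q * excess pos ≤ (p + q * u) * #live pos

  excess≤ : ∀ u pos → (∀ i → freeIn pos i ≤ suc p + u) → excess pos ≤ u * #live pos
  excess≤ u pos bounded = ≤-trans (sum-mono perBox) (≤-reflexive (sym (*-distribˡ-sum u (𝟙 ∘ live pos))))
    where
    perBox : ∀ i → freeIn pos i ∸ suc p ≤ u * 𝟙 (live pos i)
    perBox i with freeIn pos i | bounded i
    ... | zero  | _ = z≤n
    ... | suc _ | h = ≤-trans (∸-monoˡ-≤ (suc p) h)
                              (≤-reflexive (trans (m+n∸m≡n (suc p) u) (sym (*-identityʳ u))))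

  startPhase : ∀ u pos → Clean pos → (∀ i → freeIn pos i ≤ suc p + u) → G u ≤ #live pos →
    Phase u (#live pos) pos
  startPhase u pos clean bounded enough = record
    { clean = clean ; bounded = bounded ; enough = enough
    ; potential = potential-fresh p q u (#live pos) (excess pos) (excess≤ u pos bounded) }

  phase-minLive : ∀ {u L₀ pos} → Phase u L₀ pos → minLive u ≤ #live pos
  phase-minLive {u} {L₀} {pos} ph =
    minLive-bound u L₀ (#live pos) (excess pos) (Phase.enough ph) (Phase.potential ph)

  phase-live : ∀ {u L₀ pos} → Phase u L₀ pos → suc q ≤ #live pos
  phase-live {u} ph = ≤-trans (minLive≥ u) (phase-minLive ph)

  live⇒1≤#free : ∀ pos → 1 ≤ #live pos → 1 ≤ #free pos
  live⇒1≤#free pos 1≤#live with count-witness (live pos) 1≤#live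
  ... | i , isLive = ≤-trans (live⇒ pos i isLive) (freeIn≤#free pos i)

  phase-free : ∀ {u L₀ pos} → Phase u L₀ pos → 1 ≤ #free pos
  phase-free {pos = pos} ph = live⇒1≤#free pos (≤-trans (s≤s z≤n) (phase-live ph))

  trimToPhase : ∀ u r pos → Clean pos → r ≤ count (within (suc p + u) pos) →
    G u + (count (above (suc p + u) pos) + r) ≤ #live pos →
    let next = kill (trim (suc p + u) r pos) pos in Phase u (#live next) next
  trimToPhase u r pos clean r≤ enough =
    startPhase u next (clean-kill K pos clean) (trim-bounded t r pos) (+-cancelʳ-≤ _ _ _ (begin
      G u + count K                    ≡⟨ cong (G u +_) (#trim t r pos r≤) ⟩
      G u + (count (above t pos) + r)  ≤⟨ enough ⟩
      #live pos                        ≡⟨ #live-kill K pos (trim⊆live t r pos) ⟩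
      #live next + count K             ∎))
    where
    open ≤-Reasoning
    t : ℕ
    t = suc p + u
    K : Fin n → Bool
    K = trim t r pos
    next : Position m
    next = kill K pos

  -- A calm Avoider move in phase u: he claimed at least p cells, all in
  -- live boxes that keep more than p + 1 free cells, so the excess drops by
  -- the number of claimed cells while the live boxes stay the same.
  module CalmMove {u L₀ pos S} (ph : Phase u L₀ pos) (legal : Legal p pos S) (calm : Calm pos S) where

    after : Position m
    after = claim avoider S pos

    S⊆free : S ⊆free pos
    S⊆free = legal⇒⊆free pos S legal

    inBoxS : Fin n → ℕ
    inBoxS i = count (λ x → inBox i x ∧ lookup S x)

    p≤∣S∣ : p ≤ count (lookup S)
    p≤∣S∣ = bySize (proj₂ legal)
      where
      bySize : p ≤ ∣ S ∣ ⊎ (∀ x → lookup pos x ≡ free → x ∈ S) → p ≤ count (lookup S)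
      bySize (inj₁ p≤∣S∣) = ≤-trans p≤∣S∣ (≤-reflexive (∣∣≡count S))
      bySize (inj₂ takesAll) with count-witness (live pos) (≤-trans (s≤s z≤n) (phase-live ph))
      ... | i , isLive = ⊥-elim (noRoom (≤-trans (calm i isLive) (≤-reflexive (over⇒freeIn≡0 after over i))))
        where
        noRoom : suc p ≤ 0 → ⊥
        noRoom ()
        over : IsOver after
        over = covering⇒over refl pos S (λ x x-free → []=⇒lookup (takesAll x (isFree⇒ x-free)))

    excess-drop : excess pos ≡ excess after + count (lookup S)
    excess-drop = trans (sum-cong-≗ perBox)
      (trans (∑-distrib-+ (λ i → freeIn after i ∸ suc p) inBoxS) (cong (excess after +_) (sym (decompose (lookup S)))))
      where
      perBox : ∀ i → freeIn pos i ∸ suc p ≡ (freeIn after i ∸ suc p) + inBoxS i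
      perBox i with live pos i in isLive
      ... | true  = trans (cong (_∸ suc p) (freeIn-claim refl pos S S⊆free i)) (+-∸-comm (inBoxS i) (calm i isLive))
      ... | false = begin
        freeIn pos i ∸ suc p                     ≡⟨ cong (_∸ suc p) empty ⟩
        0                                        ≡⟨ cong₂ (λ a c → (a ∸ suc p) + c) (m+n≡0⇒m≡0 (freeIn after i) split)
                                                                                   (m+n≡0⇒n≡0 (freeIn after i) split) ⟨
        (freeIn after i ∸ suc p) + inBoxS i      ∎
        where
        open ≡-Reasoning
        empty : freeIn pos i ≡ 0
        empty = dead⇒empty pos i isLive
        split : freeIn after i + inBoxS i ≡ 0
        split = trans (sym (freeIn-claim refl pos S S⊆free i)) empty

    #live-after : #live after ≡ #live pos
    #live-after = count-cong same
      where
      same : ∀ i → live after i ≡ live pos i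
      same i with live pos i in isLive
      ... | true  = ⇒live after i (≤-trans (s≤s z≤n) (calm i isLive))
      ... | false = ⌊⌋-false (1 ≤? freeIn after i) (λ 1≤free →
                      1+n≰n (≤-trans 1≤free (≤-trans (freeIn-claim≤ refl pos S S⊆free i)
                                                     (≤-reflexive (dead⇒empty pos i isLive)))))

    #free-after< : #free after < #free pos
    #free-after< = begin-strict
      #free after                       <⟨ m<m+n (#free after) (≤-trans hp p≤∣S∣) ⟩
      #free after + count (lookup S)    ≡⟨ #free-claim refl pos S S⊆free ⟨
      #free pos                         ∎
      where open ≤-Reasoning

    clean-after : Clean after
    clean-after = clean-avoider pos S S⊆free (Phase.clean ph)

    bounded-after : ∀ i → freeIn after i ≤ suc p + u
    bounded-after i = ≤-trans (freeIn-claim≤ refl pos S S⊆free i) (Phase.bounded ph i)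

  -- In phase 0 every live box has at most p + 1 free cells, so no Avoider
  -- move is calm.
  noCalmInPhase0 : ∀ {L₀ pos S} → Phase 0 L₀ pos → Legal p pos S → Calm pos S → ⊥
  noCalmInPhase0 {pos = pos} {S} ph legal calm = 1+n≰n (begin
    1                                   ≤⟨ ≤-trans hp p≤∣S∣ ⟩
    count (lookup S)                    ≤⟨ m≤n+m _ (excess after) ⟩
    excess after + count (lookup S)     ≡⟨ excess-drop ⟨
    excess pos                          ≤⟨ excess≤ 0 pos (Phase.bounded ph) ⟩
    0                                   ∎)
    where
    open ≤-Reasoning
    open CalmMove ph legal calm

  -- After a calm move in phase u + 1 with at least q boxes at the top level
  -- p + 2 + u, Enforcer kills q of them and phase u + 1 continues.
  module Stay {u L₀ pos S} (ph : Phase (suc u) L₀ pos) (legal : Legal p pos S) (calm : Calm pos S)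
              (manyTop : q ≤ count (above (p + suc u) (claim avoider S pos))) where
    open CalmMove ph legal calm public

    top : Fin n → Bool
    top = above (p + suc u) after

    J : Fin n → Bool
    J = takeFirst q top

    next : Position m
    next = kill J after

    J⊆live : J ⊆ᵇ live after
    J⊆live i Ji = above⊆live (p + suc u) after i (takeFirst-⊆ q top i Ji)

    #J : count J ≡ q
    #J = takeFirst-count q top manyTop

    atTop : ∀ i → J i ≡ true → freeIn after i ∸ suc p ≡ suc u
    atTop i Ji = trans (cong (_∸ suc p) (≤-antisym (bounded-after i) isTop)) (m+n∸m≡n (suc p) (suc u))
      where
      isTop : p + suc u < freeIn after i
      isTop = ⌊⌋⇒ (p + suc u <? freeIn after i) (takeFirst-⊆ q top i Ji)

    excess-next : excess pos ≡ (excess next + suc u * q) + count (lookup S)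
    excess-next = begin
      excess pos                                       ≡⟨ excess-drop ⟩
      excess after + count (lookup S)                  ≡⟨ cong (_+ count (lookup S)) (excess-kill J after) ⟩
      (excess next + killedExcess) + count (lookup S)  ≡⟨ cong (λ z → (excess next + z) + count (lookup S)) killed≡ ⟩
      (excess next + suc u * q) + count (lookup S)     ∎
      where
      open ≡-Reasoning
      killedExcess : ℕ
      killedExcess = sum (λ i → if J i then freeIn after i ∸ suc p else 0)
      killed : ∀ i → (if J i then freeIn after i ∸ suc p else 0) ≡ (if J i then suc u else 0)
      killed i with J i in Ji
      ... | true  = atTop i Ji
      ... | false = refl
      killed≡ : killedExcess ≡ suc u * q
      killed≡ = trans (sum-cong-≗ killed) (trans (sum-if-const J (suc u)) (cong (suc u *_) #J))

    #live-next : #live pos ≡ #live next + q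
    #live-next = trans (sym #live-after) (trans (#live-kill J after J⊆live) (cong (#live next +_) #J))

    phase : Phase (suc u) L₀ next
    phase = record
      { clean     = clean-kill J after clean-after
      ; bounded   = λ i → ≤-trans (freeIn-kill≤ J after i) (bounded-after i)
      ; enough    = Phase.enough ph
      ; potential = potential-step p q (suc u) L₀ (excess next) (#live next) (count (lookup S)) p≤∣S∣
                      (subst₂ (λ Z L → p * L₀ + q * Z ≤ (p + q * suc u) * L) excess-next #live-next
                              (Phase.potential ph))
      }

    #free-next< : #free next < #free pos
    #free-next< = ≤-<-trans (#free-kill≤ J after) #free-after<

  -- After a calm move in phase u + 1 with fewer than q boxes at the top
  -- level, Enforcer kills all of them and further live boxes, q in total,
  -- and phase u starts.
  module Descend {u L₀ pos S} (ph : Phase (suc u) L₀ pos) (legal : Legal p pos S) (calm : Calm pos S)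
                 (fewTop : ¬ q ≤ count (above (p + suc u) (claim avoider S pos))) where
    open CalmMove ph legal calm public

    t : ℕ
    t = suc p + u
    #top : ℕ
    #top = count (above t after)

    #top≤q : #top ≤ q
    #top≤q = <⇒≤ (≰⇒> (fewTop ∘ subst (λ s → q ≤ count (above s after)) (sym (+-suc p u))))

    r : ℕ
    r = q ∸ #top

    K : Fin n → Bool
    K = trim t r after

    next : Position m
    next = kill K after

    G+q≤#live : G u + q ≤ #live after
    G+q≤#live = ≤-trans (phase-minLive ph) (≤-reflexive (sym #live-after))

    r≤within : r ≤ count (within t after)
    r≤within = +-cancelˡ-≤ #top r _ (begin
      #top + r                                 ≡⟨ m+[n∸m]≡n #top≤q ⟩
      q                                        ≤⟨ ≤-trans (m≤n+m q (G u)) G+q≤#live ⟩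
      #live after                              ≡⟨ #live-split t after ⟩
      #top + count (within t after)            ∎)
      where open ≤-Reasoning

    #K : count K ≡ q
    #K = trans (#trim t r after r≤within) (m+[n∸m]≡n #top≤q)

    phase : Phase u (#live next) next
    phase = trimToPhase u r after clean-after r≤within
              (≤-trans (≤-reflexive (cong (G u +_) (m+[n∸m]≡n #top≤q))) G+q≤#live)

  -- Enforcer's strategy wins from every phase position with Avoider to
  -- move; the recursion is on the phase and, within a phase, on the number
  -- of free cells.
  mutual
    phaseWin : ∀ u fuel {L₀ pos} → #free pos ≤ fuel → Phase u L₀ pos → Win Avoider pos
    phaseWin u zero #free≤0 ph = ⊥-elim (1+n≰n (≤-trans (phase-free ph) #free≤0))
    phaseWin u (suc f) {pos = pos} #free≤ ph = avoMove (notOver pos (phase-free ph)) λ S legal →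
      respond u f #free≤ ph legal (avoiderMove pos S (Phase.clean ph) (phase-live ph) legal)

    respond : ∀ u f {L₀ pos S} → #free pos ≤ suc f → Phase u L₀ pos → Legal p pos S →
      Win Enforcer (claim avoider S pos) ⊎ Calm pos S → Win Enforcer (claim avoider S pos)
    respond u f _ _ _ (inj₁ win) = win
    respond u f {pos = pos} {S} #free≤ ph legal (inj₂ calm) =
      killTop u f #free≤ ph legal calm (q ≤? count (above (p + u) (claim avoider S pos)))

    killTop : ∀ u f {L₀ pos S} → #free pos ≤ suc f → Phase u L₀ pos → Legal p pos S → Calm pos S →
      Dec (q ≤ count (above (p + u) (claim avoider S pos))) → Win Enforcer (claim avoider S pos)
    killTop zero    f _ ph legal calm _ = ⊥-elim (noCalmInPhase0 ph legal calm)
    killTop (suc u) f #free≤ ph legal calm (yes manyTop) =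
      killLive J after J⊆live (≤-reflexive (sym #J)) (phaseWin (suc u) f (s≤s⁻¹ (≤-trans #free-next< #free≤)) phase)
      where open Stay ph legal calm manyTop
    killTop (suc u) f #free≤ ph legal calm (no fewTop) =
      killLive K after (trim⊆live t r after) (≤-reflexive (sym #K)) (phaseWin u (#free next) ≤-refl phase)
      where open Descend ph legal calm fewTop

  -- Opening: Enforcer to move, in a clean position with at least G u + q
  -- live boxes of at most p + 1 + u free cells, kills all larger boxes and
  -- q of these, which starts phase u.
  opening : ∀ u pos → Clean pos → G u + q ≤ count (within (suc p + u) pos) → Win Enforcer pos
  opening u pos clean enough =
    killLive K pos (trim⊆live t q pos) (≤-trans (m≤n+m q _) (≤-reflexive (sym #K)))
      (phaseWin u (#free next) ≤-refl (trimToPhase u q pos clean q≤within G-bound))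
    where
    t : ℕ
    t = suc p + u
    K : Fin n → Bool
    K = trim t q pos
    next : Position m
    next = kill K pos
    #above : ℕ
    #above = count (above t pos)
    q≤within : q ≤ count (within t pos)
    q≤within = ≤-trans (m≤n+m q (G u)) enough
    #K : count K ≡ #above + q
    #K = #trim t q pos q≤within
    G-bound : G u + (#above + q) ≤ #live pos
    G-bound = begin
      G u + (#above + q)          ≡⟨ +-comm (G u) _ ⟩
      #above + q + G u            ≡⟨ +-assoc #above q (G u) ⟩
      #above + (q + G u)          ≡⟨ cong (#above +_) (+-comm q (G u)) ⟩
      #above + (G u + q)          ≤⟨ +-monoʳ-≤ #above enough ⟩
      #above + count (within t pos) ≡⟨ #live-split t pos ⟨
      #live pos                   ∎
      where open ≤-Reasoning

  ⇒within : ∀ t pos i → live pos i ≡ true → freeIn pos i ≤ t → within t pos i ≡ true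
  ⇒within t pos i isLive free≤t = cong₂ _∧_ isLive (cong not (⌊⌋-false (t <? freeIn pos i) (≤⇒≯ free≤t)))

  clean-initial : Clean initial
  clean-initial i x _ owned with trans (sym (lookup-replicate x free)) owned
  ... | ()

  freeIn-initial : ∀ i → freeIn initial i ≡ b i
  freeIn-initial i = trans (count-cong allFree′) (boxSize i)
    where
    allFree′ : ∀ x → (inBox i x ∧ unclaimed initial x) ≡ inBox i x
    allFree′ x = trans (cong (λ o → inBox i x ∧ isFree o) (lookup-replicate x free)) (∧-identityʳ _)

  enforcerFirst : ∀ u → (∀ i → 1 ≤ b i) → G u + q ≤ count (λ i → ⌊ b i ≤? suc p + u ⌋) →
    Win Enforcer initial
  enforcerFirst u nonempty enough = opening u initial clean-initial (≤-trans enough (count-mono small⇒within))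
    where
    small⇒within : (λ i → ⌊ b i ≤? suc p + u ⌋) ⊆ᵇ within (suc p + u) initial
    small⇒within i small = ⇒within _ initial i
      (⇒live initial i (subst (1 ≤_) (sym (freeIn-initial i)) (nonempty i)))
      (subst (_≤ suc p + u) (sym (freeIn-initial i)) (⌊⌋⇒ (b i ≤? suc p + u) small))

  avoiderFirst : ∀ u → (∀ i → 1 ≤ b i) → G u + q ≤ count (λ i → ⌊ b i ≤? suc p + u ⌋) →
    Win Avoider initial
  avoiderFirst u nonempty enough = avoMove (notOver initial 1≤#free) firstMove
    where
    small : Fin n → Bool
    small i = ⌊ b i ≤? suc p + u ⌋
    1≤#free : 1 ≤ #free initial
    1≤#free with count-witness small (≤-trans (≤-trans hq (m≤n+m q (G u))) enough)
    ... | i , _ = ≤-trans (subst (1 ≤_) (sym (freeIn-initial i)) (nonempty i)) (freeIn≤#free initial i)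
    firstMove : ∀ S → Legal p initial S → Win Enforcer (claim avoider S initial)
    firstMove S legal with fillsOrKeepsLive initial S clean-initial (legal⇒⊆free initial S legal)
    ... | inj₁ win       = win
    ... | inj₂ stillLive = opening u after (clean-avoider initial S (legal⇒⊆free initial S legal) clean-initial)
                             (≤-trans enough (count-mono small⇒within))
      where
      after : Position m
      after = claim avoider S initial
      small⇒within : small ⊆ᵇ within (suc p + u) after
      small⇒within i isSmall = ⇒within _ after i
        (stillLive i (⇒live initial i (subst (1 ≤_) (sym (freeIn-initial i)) (nonempty i))))
        (≤-trans (freeIn-claim≤ refl initial S (legal⇒⊆free initial S legal) i)
          (subst (_≤ suc p + u) (sym (freeIn-initial i)) (⌊⌋⇒ (b i ≤? suc p + u) isSmall)))

-- Theorem 1.7: choose N = (2k + 1)(G (2k) + q).  Among the first N boxes at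
-- least G (2k) + q have at most 2k ≤ p + 1 + 2k elements, and Enforcer wins
-- both as first and as second player.
theorem1p7 : (p q : ℕ) → 1 ≤ p → 1 ≤ q → (k : ℕ) → 1 ≤ k →
    Σ ℕ (λ N → 1 ≤ N ×
      ((n : ℕ) → N ≤ n → (b : Fin n → ℕ) →
        ((i : Fin n) → 1 ≤ b i) →
        ((i j : Fin n) → i F.≤ j → b i ≤ b j) →
        prefixSum N b ≤ k * N →
        EnforcerWinsBox p q b Enforcer × EnforcerWinsBox p q b Avoider))
theorem1p7 p q hp hq k _ = N , 1≤N , wins
  where
  open Thresholds p q hp using (G)
  U M N : ℕ
  U = k + k
  M = G U + q
  N = suc U * M
  1≤N : 1 ≤ N
  1≤N = ≤-trans (≤-trans hq (m≤n+m q (G U))) (m≤m+n M (U * M))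
  wins : (n : ℕ) → N ≤ n → (b : Fin n → ℕ) → ((i : Fin n) → 1 ≤ b i) →
    ((i j : Fin n) → i F.≤ j → b i ≤ b j) → prefixSum N b ≤ k * N →
    EnforcerWinsBox p q b Enforcer × EnforcerWinsBox p q b Avoider
  wins n N≤n b nonempty _ prefix≤ = enforcerFirst U nonempty enough , avoiderFirst U nonempty enough
    where
    open BoxGame p q hp hq b using (enforcerFirst; avoiderFirst)
    enough : M ≤ count (λ i → ⌊ b i ≤? suc p + U ⌋)
    enough = ≤-trans (many-small-boxes k M n b N≤n prefix≤)
                     (count-mono (λ i small → ⌊⌋-true (b i ≤? suc p + U)
                                                 (≤-trans (⌊⌋⇒ (b i ≤? U) small) (m≤n+m U (suc p)))))
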